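{- Let $(G,F,\mathcal{C})$ be a framework and let $C_1,C_2\in\mathcal{C}$ be distinct with $|E(C_1\cap C_2)|\ge 2$. Then $|E(C_1)|\ge 4$.
   Context: All graphs are finite and simple; paths and circuits have no repeated vertices. The ends of a path are its first and last vertices, its end-edges its first and last edges. For a set of edges $E'$, $G\setminus E'$ is obtained from $G$ by deleting those edges (keeping all vertices). For a path or circuit $C$, a sequence of vertices/edges is "in order" in $C$ if they are met in that order traversing $C$ (from one end if $C$ is a path; from some starting point if $C$ is a circuit). A framework is a triple $(G,F,\mathcal{C})$ where $G$ is cubic, $F$ is a subgraph of $G$, and $\mathcal{C}$ is a set of subgraphs of $G\setminus E(F)$, satisfying (F1)–(F7) below. Distinct edges $e,f$ are twinned if there exist distinct $C_1,C_2\in\mathcal{C}$ with $e,f\in E(C_1\cap C_2)$. (F1) Each member of $\mathcal{C}$ is an induced subgraph of $G\setminus E(F)$, has at least three edges, and is a path or a circuit. (F2) Every edge of $G\setminus E(F)$ belongs to some member of $\mathcal{C}$, and for every two edges $e,f$ of $G$ with a common end not in $V(F)$ there exists $C\in\mathcal{C}$ with $e,f\in E(C)$. (F3) If $C_1,C_2\in\mathcal{C}$ are distinct and $v\in V(C_1\cap C_2)$, then either $V(C_1\cap C_2)=\{v\}$, or $v$ is incident with an edge of $C_1\cap C_2$, or $v\in V(F)$. (F4) If $C_1\in\mathcal{C}$ is a path, every member of $\mathcal{C}$ containing an end-edge of $C_1$ is a path; and if $C_2\in\mathcal{C}\setminus\{C_1\}$ is also a path, then every component of $C_1\cap C_2$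 contains an end of $C_1$, and every edge of $C_1\cap C_2$ is an end-edge of $C_1$. (F5) If $C\in\mathcal{C}$ is a circuit then $|V(C\cap F)|\le 1$ and every vertex of $C\cap F$ has degree 1 in $F$; if $C\in\mathcal{C}$ is a path then every vertex of $C\cap F$ is an end of $C$ and has degree 0 or 2 in $F$. (F6) If $e,f$ are twinned and $C\in\mathcal{C}$ with $e\in E(C)$, then $|V(C)|\le 6$ and either: $f\in E(C)$, $C$ is a circuit, $e,f$ have a common end in $V(F)$, and no path in $\mathcal{C}$ contains any vertex of $e$ or $f$; or $f\in E(C)$, $C$ is a path with end-edges $e,f$, and $C\cap F$ is null; or $f\notin E(C)$, $C$ is a path with $|E(C)|=3$, $e$ is an end-edge of $C$, and no end of $e$ is in $V(F)$. (F7) Let $C\in\mathcal{C}$ be a path of length five with twinned end-edges $e,f$. Then $|E(C')|\le 4$ for every path $C'\in\mathcal{C}\setminus\{C\}$ containing $e$. Moreover, let $C$ have vertices $v_0,v_1,\dots,v_5$ in order; then there exists $C'\in\mathcal{C}$ with end-edges $e$ and $f$ and with ends $v_0$ and $v_4$. -}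

module Defs where

open import Data.Nat using (ℕ; zero; suc; _≤_)
open import Data.Fin using (Fin; zero; suc; inject₁; fromℕ; _≟_)
open import Data.Fin.Subset using (Subset; _∈_; _∉_; _∩_; ∣_∣)
open import Data.Vec using (tabulate)
open import Data.Bool using (_∨_)
open import Data.Product using (Σ; ∃; ∃-syntax; _×_; _,_; proj₁; proj₂; swap)
open import Data.Sum using (_⊎_)
open import Relation.Nullary using (¬_; does)
open import Relation.Binary.PropositionalEquality using (_≡_; _≢_)
open import Function.Definitions using (Injective)

infix 1 _⟺_
_⟺_ : Set → Set → Set
A ⟺ B = (A → B) × (B → A)

-- A finite simple cubic graph: vertices Fin n, edges Fin m,
-- each edge given by its (ordered, arbitrary orientation) pair of ends.
record Graph : Set where
  field
    n m      : ℕ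
    ends     : Fin m → Fin n × Fin n
    loopless : ∀ e → proj₁ (ends e) ≢ proj₂ (ends e)
    noParallel : ∀ e f → (ends e ≡ ends f) ⊎ (ends e ≡ swap (ends f)) → e ≡ f
  inc : Fin n → Subset m
  inc v = tabulate (λ e → does (v ≟ proj₁ (ends e)) ∨ does (v ≟ proj₂ (ends e)))
  field
    cubic : ∀ v → ∣ inc v ∣ ≡ 3

module _ (G : Graph) where
  open Graph G

  SG : Set
  SG = Subset n × Subset m

  V : SG → Subset n
  V = proj₁

  E : SG → Subset m
  E = proj₂

  Incident : Fin n → Fin m → Set
  Incident v e = (v ≡ proj₁ (ends e)) ⊎ (v ≡ proj₂ (ends e))

  EdgeBetween : Fin n → Fin n → Fin m → Set
  EdgeBetween u v e = (ends e ≡ (u , v)) ⊎ (ends e ≡ (v , u))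

  IsSubgraph : SG → Set
  IsSubgraph H = ∀ e → e ∈ E H → (proj₁ (ends e) ∈ V H) × (proj₂ (ends e) ∈ V H)

  _⊓_ : SG → SG → SG
  H ⊓ K = (V H ∩ V K , E H ∩ E K)

  deg : SG → Fin n → ℕ
  deg H v = ∣ E H ∩ inc v ∣

  PathSeq : SG → (k : ℕ) → (Fin (suc k) → Fin n) → Set
  PathSeq H k p =
    Injective _≡_ _≡_ p
    × (∀ v → v ∈ V H ⟺ (∃[ i ] p i ≡ v))
    × (∀ (i : Fin k) → ∃[ e ] EdgeBetween (p (inject₁ i)) (p (suc i)) e)
    × (∀ e → e ∈ E H ⟺ (∃[ i ] EdgeBetween (p (inject₁ i)) (p (suc i)) e))

  CircSeq : SG → (k : ℕ) → (Fin (suc k) → Fin n) → Set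
  CircSeq H k p =
    2 ≤ k
    × Injective _≡_ _≡_ p
    × (∀ v → v ∈ V H ⟺ (∃[ i ] p i ≡ v))
    × (∀ (i : Fin k) → ∃[ e ] EdgeBetween (p (inject₁ i)) (p (suc i)) e)
    × (∃[ e ] EdgeBetween (p (fromℕ k)) (p zero) e)
    × (∀ e → e ∈ E H ⟺ ((∃[ i ] EdgeBetween (p (inject₁ i)) (p (suc i)) e)
                         ⊎ EdgeBetween (p (fromℕ k)) (p zero) e))

  IsPath : SG → Set
  IsPath H = ∃[ k ] ∃[ p ] PathSeq H k p

  IsCircuit : SG → Set
  IsCircuit H = ∃[ k ] ∃[ p ] CircSeq H k p

  IsEnd : SG → Fin n → Set
  IsEnd H v = ∃[ k ] ∃[ p ] (PathSeq H k p × ((p zero ≡ v) ⊎ (p (fromℕ k) ≡ v)))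

  IsEndEdge : SG → Fin m → Set
  IsEndEdge H e = e ∈ E H × ∃[ v ] (IsEnd H v × Incident v e)

  data Reach (H : SG) : Fin n → Fin n → Set where
    here : ∀ {v} → v ∈ V H → Reach H v v
    step : ∀ {u w v} e → e ∈ E H → EdgeBetween u w e → Reach H w v → Reach H u v

  module _ (F : SG) (𝒞 : SG → Set) where

    Twinned : Fin m → Fin m → Set
    Twinned e f = e ≢ f × ∃[ C₁ ] ∃[ C₂ ]
      (𝒞 C₁ × 𝒞 C₂ × C₁ ≢ C₂ × e ∈ E C₁ ∩ E C₂ × f ∈ E C₁ ∩ E C₂)

    F1 : Set
    F1 = ∀ C → 𝒞 C →
      IsSubgraph C
      × (∀ e → e ∈ E C → e ∉ E F)
      × (∀ e → e ∉ E F → proj₁ (ends e) ∈ V C → proj₂ (ends e) ∈ V C → e ∈ E C)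
      × 3 ≤ ∣ E C ∣
      × (IsPath C ⊎ IsCircuit C)

    F2 : Set
    F2 = (∀ e → e ∉ E F → ∃[ C ] (𝒞 C × e ∈ E C))
       × (∀ e f v → e ≢ f → Incident v e → Incident v f → v ∉ V F →
            ∃[ C ] (𝒞 C × e ∈ E C × f ∈ E C))

    F3 : Set
    F3 = ∀ C₁ C₂ → 𝒞 C₁ → 𝒞 C₂ → C₁ ≢ C₂ → ∀ v → v ∈ V C₁ ∩ V C₂ →
      (∀ w → w ∈ V C₁ ∩ V C₂ → w ≡ v)
      ⊎ (∃[ e ] (e ∈ E C₁ ∩ E C₂ × Incident v e))
      ⊎ v ∈ V F

    F4 : Set
    F4 = ∀ C₁ → 𝒞 C₁ → IsPath C₁ →
      (∀ e → IsEndEdge C₁ e → ∀ C → 𝒞 C → e ∈ E C → IsPath C)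
      × (∀ C₂ → 𝒞 C₂ → C₂ ≢ C₁ → IsPath C₂ →
           (∀ v → v ∈ V C₁ ∩ V C₂ → ∃[ u ] (IsEnd C₁ u × Reach (C₁ ⊓ C₂) v u))
           × (∀ e → e ∈ E C₁ ∩ E C₂ → IsEndEdge C₁ e))

    F5 : Set
    F5 = ∀ C → 𝒞 C →
      (IsCircuit C → ∣ V C ∩ V F ∣ ≤ 1 × (∀ v → v ∈ V C ∩ V F → deg F v ≡ 1))
      × (IsPath C → ∀ v → v ∈ V C ∩ V F →
           IsEnd C v × ((deg F v ≡ 0) ⊎ (deg F v ≡ 2)))

    F6 : Set
    F6 = ∀ e f → Twinned e f → ∀ C → 𝒞 C → e ∈ E C →
      ∣ V C ∣ ≤ 6
      × ( (f ∈ E C × IsCircuit C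
             × (∃[ v ] (Incident v e × Incident v f × v ∈ V F))
             × (∀ P → 𝒞 P → IsPath P → ∀ v → (Incident v e ⊎ Incident v f) → v ∉ V P))
        ⊎ (f ∈ E C × IsPath C × IsEndEdge C e × IsEndEdge C f
             × (∀ v → v ∈ V C → v ∉ V F))
        ⊎ (f ∉ E C × IsPath C × ∣ E C ∣ ≡ 3 × IsEndEdge C e
             × (∀ v → Incident v e → v ∉ V F)))

    F7 : Set
    F7 = ∀ C → 𝒞 C → IsPath C → ∣ E C ∣ ≡ 5 → ∀ e f →
      IsEndEdge C e → IsEndEdge C f → Twinned e f →
      (∀ C′ → 𝒞 C′ → C′ ≢ C → IsPath C′ → e ∈ E C′ → ∣ E C′ ∣ ≤ 4)
      × (∀ p → PathSeq C 5 p →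
           ∃[ C′ ] (𝒞 C′ × IsEndEdge C′ e × IsEndEdge C′ f
                    × IsEnd C′ (p zero) × IsEnd C′ (p (suc (suc (suc (suc zero)))))))

    Framework : Set
    Framework = IsSubgraph F × F1 × F2 × F3 × F4 × F5 × F6 × F7

-- Let e ≠ f be shared edges; they are twinned, so (F6) applied to C₁ leaves
-- two possibilities (the third one says f ∉ E(C₁), which is absurd).
--  • C₁ is a circuit and e, f meet at a vertex v ∈ V(F).  A circuit on k+1
--    vertices has k+1 edges, so only the triangle needs an argument: there
--    e, f cover all three vertices, so C₂ (being induced) contains the whole
--    triangle; the edge opposite to v is then twinned with e, and (F6)+(F5)
--    force it through the unique F-vertex v of C₁ — impossible.
--  • C₁ is a path with end-edge e.  A path with k steps has exactly k edges
--    and (F1) gives k ≥ 3, so only k = 3 needs an argument: e, f put both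
--    inner vertices into C₂, hence also the middle edge, which by (F4) must
--    be an end-edge of C₁ — but an end of a path carries only one edge.
module Submission where

open import Defs
open import Data.Nat using (zero; suc; _+_; _≤_; z≤n; s≤s)
open import Data.Nat.Properties using (≤-trans; ≤-reflexive; ≤-antisym; +-suc; +-monoʳ-≤; m≤n⇒m<n∨m≡n)
open import Data.Fin using (Fin; zero; suc; inject₁; fromℕ; _≟_)
open import Data.Fin.Properties using (any?; 0≢1+n; suc-injective; inject₁-injective; fromℕ≢inject₁)
open import Data.Fin.Subset using (Subset; inside; outside; _∈_; _∩_; _∪_; _-_; ⁅_⁆; ∣_∣) renaming (⊥ to ∅)
open import Data.Fin.Subset.Properties using (_∈?_; nonempty?; Empty-unique; ∣⊥∣≡0; ∣⁅x⁆∣≡1; ∣p∣≤∣x∷p∣; x∈⁅x⁆; x∈p∪q⁺; x∈p∩q⁺; x∈p∩q⁻; p⊆q⇒∣p∣≤∣q∣; x∈p∧x≢y⇒x∈p-y; x∈p⇒∣p-x∣<∣p∣)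
open import Data.Vec using ([]; _∷_)
open import Data.Product using (∃-syntax; _×_; _,_; proj₁; proj₂; swap)
open import Data.Sum using (_⊎_; inj₁; inj₂)
open import Data.Empty using (⊥; ⊥-elim)
open import Function using (_∘_)
open import Function.Definitions using (Injective)
open import Relation.Nullary using (¬_; yes; no; contradiction)
open import Relation.Nullary.Decidable using (_×-dec_; ¬?; decidable-stable)
open import Relation.Binary.PropositionalEquality using (_≡_; _≢_; refl; sym; trans; cong; subst)

-- Counting members of finite subsets

∣p∪q∣≤∣p∣+∣q∣ : ∀ {n} (p q : Subset n) → ∣ p ∪ q ∣ ≤ ∣ p ∣ + ∣ q ∣
∣p∪q∣≤∣p∣+∣q∣ []            []            = z≤n
∣p∪q∣≤∣p∣+∣q∣ (outside ∷ p) (outside ∷ q) = ∣p∪q∣≤∣p∣+∣q∣ p q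
∣p∪q∣≤∣p∣+∣q∣ (outside ∷ p) (inside ∷ q)  =
  ≤-trans (s≤s (∣p∪q∣≤∣p∣+∣q∣ p q)) (≤-reflexive (sym (+-suc ∣ p ∣ ∣ q ∣)))
∣p∪q∣≤∣p∣+∣q∣ (inside ∷ p)  (s ∷ q)       =
  s≤s (≤-trans (∣p∪q∣≤∣p∣+∣q∣ p q) (+-monoʳ-≤ ∣ p ∣ (∣p∣≤∣x∷p∣ s q)))

image : ∀ {k m} → (Fin k → Fin m) → Subset m
image {zero}  f = ∅
image {suc k} f = ⁅ f zero ⁆ ∪ image (f ∘ suc)

f[i]∈image : ∀ {k m} (f : Fin k → Fin m) i → f i ∈ image f
f[i]∈image f zero    = x∈p∪q⁺ (inj₁ (x∈⁅x⁆ (f zero)))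
f[i]∈image f (suc i) = x∈p∪q⁺ (inj₂ (f[i]∈image (f ∘ suc) i))

∣image∣≤k : ∀ {k m} (f : Fin k → Fin m) → ∣ image f ∣ ≤ k
∣image∣≤k {zero} {m} f = ≤-reflexive (∣⊥∣≡0 m)
∣image∣≤k {suc k} f = ≤-trans (∣p∪q∣≤∣p∣+∣q∣ ⁅ f zero ⁆ (image (f ∘ suc)))
                              (≤-trans (≤-reflexive (cong (_+ ∣ image (f ∘ suc) ∣) (∣⁅x⁆∣≡1 (f zero))))
                                       (s≤s (∣image∣≤k (f ∘ suc))))

covered-size : ∀ {k m} {p : Subset m} (f : Fin k → Fin m) →
  (∀ {x} → x ∈ p → ∃[ i ] f i ≡ x) → ∣ p ∣ ≤ k
covered-size {p = p} f covers = ≤-trans (p⊆q⇒∣p∣≤∣q∣ in-image) (∣image∣≤k f)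
  where
  in-image : ∀ {x} → x ∈ p → x ∈ image f
  in-image x∈p with covers x∈p
  ... | i , refl = f[i]∈image f i

injection-size : ∀ {k m} {p : Subset m} (f : Fin k → Fin m) →
  Injective _≡_ _≡_ f → (∀ i → f i ∈ p) → k ≤ ∣ p ∣
injection-size {zero}          f f-inj f∈p = z≤n
injection-size {suc k} {p = p} f f-inj f∈p =
  ≤-trans (s≤s (injection-size (f ∘ suc) (suc-injective ∘ f-inj) rest∈p-f₀)) (x∈p⇒∣p-x∣<∣p∣ (f∈p zero))
  where
  rest∈p-f₀ : ∀ i → f (suc i) ∈ p - f zero
  rest∈p-f₀ i = x∈p∧x≢y⇒x∈p-y (f∈p (suc i)) (λ eq → 0≢1+n (f-inj (sym eq)))

member : ∀ {n} (p : Subset n) → 1 ≤ ∣ p ∣ → ∃[ x ] x ∈ p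
member {n} p 1≤∣p∣ with nonempty? p
... | yes p-inhabited = p-inhabited
... | no p-empty =
  contradiction (≤-trans 1≤∣p∣ (≤-reflexive (trans (cong ∣_∣ (Empty-unique p-empty)) (∣⊥∣≡0 n)))) λ ()

-- A set of size at least two has two distinct members: otherwise it would
-- be covered by a single element.
two-members : ∀ {n} (p : Subset n) → 2 ≤ ∣ p ∣ → ∃[ x ] ∃[ y ] (x ∈ p × y ∈ p × x ≢ y)
two-members p 2≤∣p∣ with member p (≤-trans (s≤s z≤n) 2≤∣p∣)
... | x , x∈p with any? (λ y → (y ∈? p) ×-dec ¬? (y ≟ x))
...   | yes (y , y∈p , y≢x) = x , y , x∈p , y∈p , y≢x ∘ sym
...   | no no-other =
  contradiction (≤-trans 2≤∣p∣ (covered-size (λ (_ : Fin 1) → x) (λ y∈p → zero , sym (only-x y∈p)))) λ { (s≤s ()) }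
  where
  only-x : ∀ {y} → y ∈ p → y ≡ x
  only-x {y} y∈p = decidable-stable (y ≟ x) (λ y≢x → no-other (y , y∈p , y≢x))

member-size : ∀ {n} {p : Subset n} {x} → x ∈ p → 1 ≤ ∣ p ∣
member-size {x = x} x∈p = injection-size (λ (_ : Fin 1) → x) (λ { {zero} {zero} _ → refl }) (λ _ → x∈p)

at-most-one : ∀ {n} {p : Subset n} {x y} → ∣ p ∣ ≤ 1 → x ∈ p → y ∈ p → x ≡ y
at-most-one {p = p} {x} {y} ∣p∣≤1 x∈p y∈p with x ≟ y
... | yes x≡y = x≡y
... | no  x≢y = contradiction (≤-trans 2≤∣p∣ ∣p∣≤1) λ { (s≤s ()) }
  where
  -- y survives the removal of x, which strictly shrinks p
  2≤∣p∣ : 2 ≤ ∣ p ∣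
  2≤∣p∣ = ≤-trans (s≤s (member-size (x∈p∧x≢y⇒x∈p-y y∈p (x≢y ∘ sym)))) (x∈p⇒∣p-x∣<∣p∣ x∈p)

no-crossed-steps : ∀ {k} (i j : Fin k) → inject₁ i ≡ suc j → suc i ≡ inject₁ j → ⊥
no-crossed-steps (suc i) zero    _ ()
no-crossed-steps (suc i) (suc j) p q = no-crossed-steps i j (suc-injective p) (suc-injective q)

no-closing-step : ∀ {k} {i : Fin k} → 2 ≤ k → fromℕ k ≡ suc i → zero ≡ inject₁ i → ⊥
no-closing-step {i = zero}  (s≤s (s≤s _)) last≡1 _ with suc-injective last≡1
... | ()

-- Edges, vertex sequences, paths and triangles in a simple graph

module SimpleGraph (G : Graph) where
  open Graph G

  same-ends : ∀ {a b c d x} → EdgeBetween G a b x → EdgeBetween G c d x →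
    (a ≡ c × b ≡ d) ⊎ (a ≡ d × b ≡ c)
  same-ends (inj₁ refl) (inj₁ eq) = inj₁ (cong proj₁ eq , cong proj₂ eq)
  same-ends (inj₁ refl) (inj₂ eq) = inj₂ (cong proj₁ eq , cong proj₂ eq)
  same-ends (inj₂ refl) (inj₁ eq) = inj₂ (cong proj₂ eq , cong proj₁ eq)
  same-ends (inj₂ refl) (inj₂ eq) = inj₁ (cong proj₂ eq , cong proj₁ eq)

  edge-unique : ∀ {u v x y} → EdgeBetween G u v x → EdgeBetween G u v y → x ≡ y
  edge-unique {x = x} {y} (inj₁ refl) (inj₁ eq) = noParallel x y (inj₁ (sym eq))
  edge-unique {x = x} {y} (inj₁ refl) (inj₂ eq) = noParallel x y (inj₂ (sym (cong swap eq)))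
  edge-unique {x = x} {y} (inj₂ refl) (inj₁ eq) = noParallel x y (inj₂ (sym (cong swap eq)))
  edge-unique {x = x} {y} (inj₂ refl) (inj₂ eq) = noParallel x y (inj₁ (sym eq))

  incident-end : ∀ {u v w x} → EdgeBetween G u v x → Incident G w x → (w ≡ u) ⊎ (w ≡ v)
  incident-end (inj₁ refl) (inj₁ w≡u) = inj₁ w≡u
  incident-end (inj₁ refl) (inj₂ w≡v) = inj₂ w≡v
  incident-end (inj₂ refl) (inj₁ w≡v) = inj₂ w≡v
  incident-end (inj₂ refl) (inj₂ w≡u) = inj₁ w≡u

  first-end : ∀ {u v x} → EdgeBetween G u v x → Incident G u x
  first-end (inj₁ refl) = inj₁ refl
  first-end (inj₂ refl) = inj₂ refl

  second-end : ∀ {u v x} → EdgeBetween G u v x → Incident G v x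
  second-end (inj₁ refl) = inj₂ refl
  second-end (inj₂ refl) = inj₁ refl

  end-in-subgraph : ∀ {H x w} → IsSubgraph G H → x ∈ E G H → Incident G w x → w ∈ V G H
  end-in-subgraph H-sub x∈H (inj₁ refl) = proj₁ (H-sub _ x∈H)
  end-in-subgraph H-sub x∈H (inj₂ refl) = proj₂ (H-sub _ x∈H)

  Step : ∀ {k} → (Fin (suc k) → Fin n) → Fin k → Fin m → Set
  Step p i x = EdgeBetween G (p (inject₁ i)) (p (suc i)) x

  module Sequence {k} {p : Fin (suc k) → Fin n} (p-inj : Injective _≡_ _≡_ p) where

    on-step : ∀ {l i x} → Step p i x → Incident G (p l) x → (l ≡ inject₁ i) ⊎ (l ≡ suc i)
    on-step on-i incident with incident-end on-i incident
    ... | inj₁ at-start = inj₁ (p-inj at-start)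
    ... | inj₂ at-end   = inj₂ (p-inj at-end)

    step-injective : ∀ {i j x} → Step p i x → Step p j x → i ≡ j
    step-injective {i} {j} step-i step-j with same-ends step-i step-j
    ... | inj₁ (start≡start , _) = inject₁-injective (p-inj start≡start)
    ... | inj₂ (start≡end , end≡start) = ⊥-elim (no-crossed-steps i j (p-inj start≡end) (p-inj end≡start))

    closing-not-step : ∀ {i x} → 2 ≤ k → EdgeBetween G (p (fromℕ k)) (p zero) x → Step p i x → ⊥
    closing-not-step 2≤k closing on-i with same-ends closing on-i
    ... | inj₁ (_ , first≡next) = 0≢1+n (p-inj first≡next)
    ... | inj₂ (last≡next , first≡start) = no-closing-step 2≤k (p-inj last≡next) (p-inj first≡start)

    end-step-unique : ∀ {u i j x y} → (p zero ≡ u) ⊎ (p (fromℕ k) ≡ u) →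
      Step p i x → Incident G u x → Step p j y → Incident G u y → i ≡ j
    end-step-unique (inj₁ refl) step-i at-i step-j at-j with on-step step-i at-i | on-step step-j at-j
    ... | inj₁ 0≡i | inj₁ 0≡j = inject₁-injective (trans (sym 0≡i) 0≡j)
    ... | inj₂ ()  | _
    ... | _        | inj₂ ()
    end-step-unique (inj₂ refl) step-i at-i step-j at-j with on-step step-i at-i | on-step step-j at-j
    ... | inj₂ k≡i+1 | inj₂ k≡j+1 = suc-injective (trans (sym k≡i+1) k≡j+1)
    ... | inj₁ k≡i   | _          = ⊥-elim (fromℕ≢inject₁ k≡i)
    ... | _          | inj₁ k≡j   = ⊥-elim (fromℕ≢inject₁ k≡j)

  module Path {H : SG G} {k} {p : Fin (suc k) → Fin n} (path : PathSeq G H k p) where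
    p-inj : Injective _≡_ _≡_ p
    p-inj = proj₁ path

    open Sequence p-inj public

    steps : ∀ i → ∃[ x ] Step p i x
    steps = proj₁ (proj₂ (proj₂ path))

    edges : ∀ x → x ∈ E G H ⟺ (∃[ i ] Step p i x)
    edges = proj₂ (proj₂ (proj₂ path))

    step-edge : Fin k → Fin m
    step-edge i = proj₁ (steps i)

    step-between : ∀ i → Step p i (step-edge i)
    step-between i = proj₂ (steps i)

    step-edge∈H : ∀ i → step-edge i ∈ E G H
    step-edge∈H i = proj₂ (edges _) (i , step-between i)

    step-index : ∀ {x} → x ∈ E G H → ∃[ i ] step-edge i ≡ x
    step-index {x} x∈H with proj₁ (edges x) x∈H
    ... | i , on-i = i , edge-unique (step-between i) on-i

    step-edge-injective : Injective _≡_ _≡_ step-edge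
    step-edge-injective {i} {j} same = step-injective (step-between i) (subst (Step p j) (sym same) (step-between j))

    path-size : ∣ E G H ∣ ≡ k
    path-size = ≤-antisym (covered-size step-edge step-index) (injection-size step-edge step-edge-injective step-edge∈H)

    end-edge-unique : ∀ {u x y} → (p zero ≡ u) ⊎ (p (fromℕ k) ≡ u) →
      x ∈ E G H → Incident G u x → y ∈ E G H → Incident G u y → x ≡ y
    end-edge-unique end x∈H at-x y∈H at-y with proj₁ (edges _) x∈H | proj₁ (edges _) y∈H
    ... | i , on-i | j , on-j with end-step-unique end on-i at-x on-j at-y
    ...   | refl = edge-unique on-i on-j

  module Circuit {H : SG G} {k} {p : Fin (suc k) → Fin n} (circuit : CircSeq G H k p) where
    p-inj : Injective _≡_ _≡_ p
    p-inj = proj₁ (proj₂ circuit)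

    open Sequence p-inj public

    vertex-index : ∀ {w} → w ∈ V G H → ∃[ j ] p j ≡ w
    vertex-index w∈H = proj₁ (proj₁ (proj₂ (proj₂ circuit)) _) w∈H

    steps : ∀ i → ∃[ x ] Step p i x
    steps = proj₁ (proj₂ (proj₂ (proj₂ circuit)))

    closing-edge : Fin m
    closing-edge = proj₁ (proj₁ (proj₂ (proj₂ (proj₂ (proj₂ circuit)))))

    closing-between : EdgeBetween G (p (fromℕ k)) (p zero) closing-edge
    closing-between = proj₂ (proj₁ (proj₂ (proj₂ (proj₂ (proj₂ circuit)))))

    edges : ∀ x → x ∈ E G H ⟺ ((∃[ i ] Step p i x) ⊎ EdgeBetween G (p (fromℕ k)) (p zero) x)
    edges = proj₂ (proj₂ (proj₂ (proj₂ (proj₂ circuit))))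

    -- A circuit through k + 1 vertices has at least k + 1 edges: its steps
    -- and its closing edge are pairwise distinct.
    circuit-size : suc k ≤ ∣ E G H ∣
    circuit-size = injection-size edge distinct edge∈H
      where
      2≤k : 2 ≤ k
      2≤k = proj₁ circuit
      edge : Fin (suc k) → Fin m
      edge zero    = closing-edge
      edge (suc i) = proj₁ (steps i)
      distinct : Injective _≡_ _≡_ edge
      distinct {zero}  {zero}  _    = refl
      distinct {zero}  {suc j} same = ⊥-elim (closing-not-step 2≤k closing-between (subst (Step p j) (sym same) (proj₂ (steps j))))
      distinct {suc i} {zero}  same = ⊥-elim (closing-not-step 2≤k closing-between (subst (Step p i) same (proj₂ (steps i))))
      distinct {suc i} {suc j} same = cong suc (step-injective (proj₂ (steps i)) (subst (Step p j) (sym same) (proj₂ (steps j))))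
      edge∈H : ∀ i → edge i ∈ E G H
      edge∈H zero    = proj₂ (edges _) (inj₂ closing-between)
      edge∈H (suc i) = proj₂ (edges _) (inj₁ (i , proj₂ (steps i)))

  module Triangle {H : SG G} {p : Fin 3 → Fin n} (triangle : CircSeq G H 2 p) where
    open Circuit triangle public

    next : Fin 3 → Fin 3
    next zero             = suc zero
    next (suc zero)       = suc (suc zero)
    next (suc (suc zero)) = zero

    moves : ∀ j → (j ≢ next j) × (j ≢ next (next j))
    moves zero             = (λ ()) , (λ ())
    moves (suc zero)       = (λ ()) , (λ ())
    moves (suc (suc zero)) = (λ ()) , (λ ())

    opposite : Fin 3 → Fin m
    opposite zero             = proj₁ (steps (suc zero))
    opposite (suc zero)       = closing-edge
    opposite (suc (suc zero)) = proj₁ (steps zero)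

    opposite-between : ∀ j → EdgeBetween G (p (next j)) (p (next (next j))) (opposite j)
    opposite-between zero             = proj₂ (steps (suc zero))
    opposite-between (suc zero)       = closing-between
    opposite-between (suc (suc zero)) = proj₂ (steps zero)

    opposite∈H : ∀ j → opposite j ∈ E G H
    opposite∈H zero             = proj₂ (edges _) (inj₁ (suc zero , opposite-between zero))
    opposite∈H (suc zero)       = proj₂ (edges _) (inj₂ closing-between)
    opposite∈H (suc (suc zero)) = proj₂ (edges _) (inj₁ (zero , opposite-between (suc (suc zero))))

    opposite-misses : ∀ j → ¬ Incident G (p j) (opposite j)
    opposite-misses j at-j with incident-end (opposite-between j) at-j
    ... | inj₁ at-next      = proj₁ (moves j) (p-inj at-next)
    ... | inj₂ at-next-next = proj₂ (moves j) (p-inj at-next-next)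

    meets-or-opposite : ∀ j {x} → x ∈ E G H → Incident G (p j) x ⊎ x ≡ opposite j
    meets-or-opposite zero {x} x∈H with proj₁ (edges x) x∈H
    ... | inj₁ (zero , on-0)     = inj₁ (first-end on-0)
    ... | inj₁ (suc zero , on-1) = inj₂ (edge-unique on-1 (opposite-between zero))
    ... | inj₂ on-closing        = inj₁ (second-end on-closing)
    meets-or-opposite (suc zero) {x} x∈H with proj₁ (edges x) x∈H
    ... | inj₁ (zero , on-0)     = inj₁ (second-end on-0)
    ... | inj₁ (suc zero , on-1) = inj₁ (first-end on-1)
    ... | inj₂ on-closing        = inj₂ (edge-unique on-closing (opposite-between (suc zero)))
    meets-or-opposite (suc (suc zero)) {x} x∈H with proj₁ (edges x) x∈H
    ... | inj₁ (zero , on-0)     = inj₂ (edge-unique on-0 (opposite-between (suc (suc zero))))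
    ... | inj₁ (suc zero , on-1) = inj₁ (second-end on-1)
    ... | inj₂ on-closing        = inj₁ (first-end on-closing)

  module ThreeStepPath {H : SG G} {p : Fin 4 → Fin n} (path : PathSeq G H 3 p) where
    open Path path public

    p₁-meets : ∀ {x} → x ∈ E G H → Incident G (p (suc zero)) x ⊎ x ≡ step-edge (suc (suc zero))
    p₁-meets {x} x∈H with proj₁ (edges x) x∈H
    ... | zero , on-0             = inj₁ (second-end on-0)
    ... | suc zero , on-1         = inj₁ (first-end on-1)
    ... | suc (suc zero) , on-2   = inj₂ (edge-unique on-2 (step-between (suc (suc zero))))

    p₂-meets : ∀ {x} → x ∈ E G H → Incident G (p (suc (suc zero))) x ⊎ x ≡ step-edge zero
    p₂-meets {x} x∈H with proj₁ (edges x) x∈H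
    ... | zero , on-0             = inj₂ (edge-unique on-0 (step-between zero))
    ... | suc zero , on-1         = inj₁ (second-end on-1)
    ... | suc (suc zero) , on-2   = inj₁ (first-end on-2)

    -- The middle step is not an end-edge: each of its ends carries another step.
    middle-not-end-edge : ¬ IsEndEdge G H (step-edge (suc zero))
    middle-not-end-edge (_ , u , (_ , _ , u-path , u-end) , u-on-middle)
      with incident-end (step-between (suc zero)) u-on-middle
    ... | inj₁ refl = 0≢1+n (step-edge-injective
            (Path.end-edge-unique u-path u-end (step-edge∈H zero) (second-end (step-between zero))
                                               (step-edge∈H (suc zero)) u-on-middle))
    ... | inj₂ refl with step-edge-injective
            (Path.end-edge-unique u-path u-end (step-edge∈H (suc (suc zero))) (first-end (step-between (suc (suc zero))))
                                               (step-edge∈H (suc zero)) u-on-middle)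
    ...   | ()

-- Consequences of the framework axioms (F1), (F4), (F5), (F6)

module FrameworkFacts (G : Graph) (F : SG G) (𝒞 : SG G → Set)
  (f1 : F1 G F 𝒞) (f4 : F4 G F 𝒞) (f5 : F5 G F 𝒞) (f6 : F6 G F 𝒞) where
  open Graph G using (m)
  open SimpleGraph G

  member-subgraph : ∀ {C} → 𝒞 C → IsSubgraph G C
  member-subgraph c = proj₁ (f1 _ c)

  -- (F1) An edge of one member whose ends lie in another member belongs to it
  -- as well, since members avoid E(F) and are induced in G \ E(F).
  edge-transfer : ∀ {C D x} → 𝒞 C → 𝒞 D → x ∈ E G C → (∀ {w} → Incident G w x → w ∈ V G D) → x ∈ E G D
  edge-transfer c d x∈C ends∈D =
    proj₁ (proj₂ (proj₂ (f1 _ d))) _ (proj₁ (proj₂ (f1 _ c)) _ x∈C) (ends∈D (inj₁ refl)) (ends∈D (inj₂ refl))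

  circuit-F-vertex-unique : ∀ {C u w} → 𝒞 C → IsCircuit G C →
    u ∈ V G C → u ∈ V G F → w ∈ V G C → w ∈ V G F → u ≡ w
  circuit-F-vertex-unique c circuit u∈C u∈F w∈C w∈F =
    at-most-one (proj₁ (proj₁ (f5 _ c) circuit)) (x∈p∩q⁺ (u∈C , u∈F)) (x∈p∩q⁺ (w∈C , w∈F))

  -- (F1) A path of 𝒞 has at least three steps, since it has at least three edges.
  at-least-three-steps : ∀ {C k p} → 𝒞 C → PathSeq G C k p → 3 ≤ k
  at-least-three-steps c path = subst (3 ≤_) (Path.path-size path) (proj₁ (proj₂ (proj₂ (proj₂ (f1 _ c)))))

  module Pair (C₁ C₂ : SG G) (c₁ : 𝒞 C₁) (c₂ : 𝒞 C₂) (C₁≢C₂ : C₁ ≢ C₂) where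

    Shared : Fin m → Set
    Shared x = x ∈ E G C₁ ∩ E G C₂

    in-C₁ : ∀ {x} → Shared x → x ∈ E G C₁
    in-C₁ = proj₁ ∘ x∈p∩q⁻ _ _

    in-C₂ : ∀ {x} → Shared x → x ∈ E G C₂
    in-C₂ = proj₂ ∘ x∈p∩q⁻ _ _

    twinned : ∀ {x y} → x ≢ y → Shared x → Shared y → Twinned G F 𝒞 x y
    twinned x≢y x-shared y-shared = x≢y , C₁ , C₂ , c₁ , c₂ , C₁≢C₂ , x-shared , y-shared

    -- A vertex lying on all edges of C₁ but one lies on one of two distinct
    -- shared edges, hence in C₂.
    covered-vertex : ∀ {x y u o} → x ≢ y → Shared x → Shared y →
      Incident G u x ⊎ x ≡ o → Incident G u y ⊎ y ≡ o → u ∈ V G C₂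
    covered-vertex _   x-shared _        (inj₁ u-on-x) _             = end-in-subgraph (member-subgraph c₂) (in-C₂ x-shared) u-on-x
    covered-vertex _   _        y-shared _             (inj₁ u-on-y) = end-in-subgraph (member-subgraph c₂) (in-C₂ y-shared) u-on-y
    covered-vertex x≢y _        _        (inj₂ refl)   (inj₂ refl)   = ⊥-elim (x≢y refl)

    twin-meets-F-vertex : ∀ {x y v} → x ≢ y → Shared x → Shared y →
      IsCircuit G C₁ → v ∈ V G C₁ → v ∈ V G F → Incident G v y
    twin-meets-F-vertex x≢y x-shared y-shared circuit v∈C₁ v∈F
      with f6 _ _ (twinned x≢y x-shared y-shared) C₁ c₁ (in-C₁ x-shared)
    ... | _ , inj₁ (_ , _ , (w , _ , w-on-y , w∈F) , _) =
      subst (λ u → Incident G u _)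
        (circuit-F-vertex-unique c₁ circuit (end-in-subgraph (member-subgraph c₁) (in-C₁ y-shared) w-on-y) w∈F v∈C₁ v∈F)
        w-on-y
    ... | _ , inj₂ (inj₁ (_ , _ , _ , _ , F-free)) = ⊥-elim (F-free _ v∈C₁ v∈F)
    ... | _ , inj₂ (inj₂ (y∉C₁ , _))              = ⊥-elim (y∉C₁ (in-C₁ y-shared))

    shared-end-edge : ∀ {x y} → IsPath G C₁ → IsEndEdge G C₁ x → Shared x → Shared y → IsEndEdge G C₁ y
    shared-end-edge path x-end x-shared y-shared =
      proj₂ (proj₂ (f4 C₁ c₁ path) C₂ c₂ (C₁≢C₂ ∘ sym) (proj₁ (f4 C₁ c₁ path) _ x-end C₂ c₂ (in-C₂ x-shared)))
        _ y-shared

    -- C₁ cannot be a triangle sharing two edges x, y with C₂ where x passes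
    -- through an F-vertex v: the vertices of C₁ all lie on x or y, so C₂
    -- contains the side opposite to v, which (F6)+(F5) would force through v.
    no-shared-triangle : ∀ {p x y v} → CircSeq G C₁ 2 p → x ≢ y → Shared x → Shared y →
      Incident G v x → v ∈ V G F → ⊥
    no-shared-triangle {p} {x} {y} {v} triangle x≢y x-shared y-shared v-on-x v∈F =
      opposite-to-v (vertex-index v∈C₁)
      where
      open Triangle triangle
      v∈C₁ : v ∈ V G C₁
      v∈C₁ = end-in-subgraph (member-subgraph c₁) (in-C₁ x-shared) v-on-x
      C₁⊆C₂ : ∀ {w} → w ∈ V G C₁ → w ∈ V G C₂
      C₁⊆C₂ w∈C₁ with vertex-index w∈C₁
      ... | j , refl = covered-vertex x≢y x-shared y-shared
                         (meets-or-opposite j (in-C₁ x-shared)) (meets-or-opposite j (in-C₁ y-shared))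
      opposite-shared : ∀ j → Shared (opposite j)
      opposite-shared j = x∈p∩q⁺ (opposite∈H j , edge-transfer c₁ c₂ (opposite∈H j)
                                     (C₁⊆C₂ ∘ end-in-subgraph (member-subgraph c₁) (opposite∈H j)))
      opposite-to-v : ∃[ i ] p i ≡ v → ⊥
      opposite-to-v (i , refl) =
        opposite-misses i (twin-meets-F-vertex x≢opposite x-shared (opposite-shared i) (2 , p , triangle) v∈C₁ v∈F)
        where
        x≢opposite : x ≢ opposite i
        x≢opposite refl = opposite-misses i v-on-x

    -- C₁ cannot be a path with three steps sharing two edges x, y with C₂,
    -- one of them an end-edge: the inner vertices lie on x or y, so C₂
    -- contains the middle step, which (F4) would make an end-edge.
    no-shared-three-step-path : ∀ {p x y} → PathSeq G C₁ 3 p → IsEndEdge G C₁ x → x ≢ y →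
      Shared x → Shared y → ⊥
    no-shared-three-step-path {p} path x-end x≢y x-shared y-shared =
      middle-not-end-edge (shared-end-edge (3 , p , path) x-end x-shared middle-shared)
      where
      open ThreeStepPath path
      middle-ends∈C₂ : ∀ {w} → Incident G w (step-edge (suc zero)) → w ∈ V G C₂
      middle-ends∈C₂ w-on-middle with incident-end (step-between (suc zero)) w-on-middle
      ... | inj₁ refl = covered-vertex x≢y x-shared y-shared (p₁-meets (in-C₁ x-shared)) (p₁-meets (in-C₁ y-shared))
      ... | inj₂ refl = covered-vertex x≢y x-shared y-shared (p₂-meets (in-C₁ x-shared)) (p₂-meets (in-C₁ y-shared))
      middle-shared : Shared (step-edge (suc zero))
      middle-shared = x∈p∩q⁺ (step-edge∈H (suc zero) , edge-transfer c₁ c₂ (step-edge∈H (suc zero)) middle-ends∈C₂)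

    circuit-case : ∀ {x y v} → IsCircuit G C₁ → x ≢ y → Shared x → Shared y →
      Incident G v x → v ∈ V G F → 4 ≤ ∣ E G C₁ ∣
    circuit-case (k , p , circuit) x≢y x-shared y-shared v-on-x v∈F with m≤n⇒m<n∨m≡n (proj₁ circuit)
    ... | inj₁ 3≤k = ≤-trans (s≤s 3≤k) (Circuit.circuit-size circuit)
    ... | inj₂ refl = ⊥-elim (no-shared-triangle circuit x≢y x-shared y-shared v-on-x v∈F)

    path-case : ∀ {x y} → IsPath G C₁ → IsEndEdge G C₁ x → x ≢ y → Shared x → Shared y → 4 ≤ ∣ E G C₁ ∣
    path-case (k , p , path) x-end x≢y x-shared y-shared with m≤n⇒m<n∨m≡n (at-least-three-steps c₁ path)
    ... | inj₁ 4≤k = subst (4 ≤_) (sym (Path.path-size path)) 4≤k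
    ... | inj₂ refl = ⊥-elim (no-shared-three-step-path path x-end x≢y x-shared y-shared)

    four-edges : ∀ {x y} → x ≢ y → Shared x → Shared y → 4 ≤ ∣ E G C₁ ∣
    four-edges x≢y x-shared y-shared with f6 _ _ (twinned x≢y x-shared y-shared) C₁ c₁ (in-C₁ x-shared)
    ... | _ , inj₁ (_ , circuit , (v , v-on-x , _ , v∈F) , _) = circuit-case circuit x≢y x-shared y-shared v-on-x v∈F
    ... | _ , inj₂ (inj₁ (_ , path , x-end , _))             = path-case path x-end x≢y x-shared y-shared
    ... | _ , inj₂ (inj₂ (y∉C₁ , _))                        = ⊥-elim (y∉C₁ (in-C₁ y-shared))

theorem3p3 : (G : Graph) (F : SG G) (𝒞 : SG G → Set) →
    Framework G F 𝒞 →
    ∀ C₁ C₂ → 𝒞 C₁ → 𝒞 C₂ → C₁ ≢ C₂ →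
    2 ≤ ∣ E G C₁ ∩ E G C₂ ∣ →
    4 ≤ ∣ E G C₁ ∣
theorem3p3 G F 𝒞 (_ , f1 , _ , _ , f4 , f5 , f6 , _) C₁ C₂ c₁ c₂ C₁≢C₂ two-shared
  with two-members (E G C₁ ∩ E G C₂) two-shared
... | x , y , x-shared , y-shared , x≢y =
  FrameworkFacts.Pair.four-edges G F 𝒞 f1 f4 f5 f6 C₁ C₂ c₁ c₂ C₁≢C₂ x≢y x-shared y-shared
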